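{- For $B\geq 2$ and $|q|<1$, $$\sum_{n=1}^{\infty}\widehat{c}_B(\{1\}^n) q^n=\frac{B-1}{1-q}\sum_{i=1}^{\infty}\frac{q^{B^i}}{1-q^{B^i}}.$$
   Context: For an integer $a\geq 0$, $s_B(a)$ is the sum of its base-$B$ digits ($s_B(0)=0$). For integers $a_1,\dots,a_r\ge 0$ with base-$B$ digits $a_i=\sum_{j\ge0}\alpha_{i,j}B^j$, $0\le\alpha_{i,j}<B$, let $t\ge0$ be the largest $j$ with some $\alpha_{i,j}\ne0$ ($t=0$ if all are zero), define the carries of the traditional base-$B$ column addition algorithm by $\delta_0=\lfloor(\sum_i\alpha_{i,0})/B\rfloor$, $\delta_j=\lfloor(\sum_i\alpha_{i,j}+\delta_{j-1})/B\rfloor$ for $1\le j\le t$, carry sum $c_B(a_1,\dots,a_r)=\sum_{j=0}^t\delta_j$, terminal carry $\beta=\delta_t$, and $\widehat{c}_B(a_1,\dots,a_r):=\beta-s_B(\beta)+(B-1)c_B(a_1,\dots,a_r)$. Then $\widehat{c}_B(\{1\}^n)$ denotes $\widehat{c}_B(1,1,\dots,1)$ with $n$ copies of $1$. -}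

module Defs where

open import Data.Nat using (ℕ; zero; suc; _+_; _*_; _∸_; _^_; _≤_; _<_; NonZero; _≡ᵇ_)
open import Data.Nat.DivMod using (_/_; _%_)
open import Data.Nat.Divisibility using (_∣?_)
open import Data.Bool using (Bool; true; false; not; if_then_else_)
open import Data.List using (List; []; _∷_; map; replicate)
open import Data.Nat.ListAction using (sum)
open import Data.Bool.ListAction using (any)
open import Relation.Nullary.Decidable using (⌊_⌋)

module _ (B : ℕ) .{{_ : NonZero B}} where

  digit : ℕ → ℕ → ℕ
  digit zero    a = a % B
  digit (suc j) a = digit j (a / B)

  digitSumUpTo : ℕ → ℕ → ℕ
  digitSumUpTo zero    a = digit zero a
  digitSumUpTo (suc m) a = digitSumUpTo m a + digit (suc m) a

  -- s_B(a): digits with index j ≥ a vanish (B^j > a), so summing j = 0..a suffices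
  s : ℕ → ℕ
  s a = digitSumUpTo a a

  colSum : List ℕ → ℕ → ℕ
  colSum as j = sum (map (digit j) as)

  someNonzero : List ℕ → ℕ → Bool
  someNonzero as j = any (λ a → not (digit j a ≡ᵇ 0)) as

  topFrom : List ℕ → ℕ → ℕ
  topFrom as zero    = zero
  topFrom as (suc m) = if someNonzero as (suc m) then suc m else topFrom as m

  -- t: largest j with some α_{i,j} ≠ 0 (t = 0 if all zero); all digits with
  -- index j ≥ Σ a_i vanish, so searching j ≤ Σ a_i suffices
  top : List ℕ → ℕ
  top as = topFrom as (sum as)

  carry : List ℕ → ℕ → ℕ
  carry as zero    = colSum as zero / B
  carry as (suc j) = (colSum as (suc j) + carry as j) / B

  carrySumUpTo : List ℕ → ℕ → ℕ
  carrySumUpTo as zero    = carry as zero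
  carrySumUpTo as (suc m) = carrySumUpTo as m + carry as (suc m)

  c : List ℕ → ℕ
  c as = carrySumUpTo as (top as)

  β : List ℕ → ℕ
  β as = carry as (top as)

  -- ĉ_B(a_1,…,a_r) = β − s_B(β) + (B−1) c_B  (β ≥ s_B(β), so ∸ is exact)
  ĉ : List ℕ → ℕ
  ĉ as = (β as ∸ s (β as)) + (B ∸ 1) * c as

-- Formal power series with ℕ coefficients: f n = coefficient of q^n

FPS : Set
FPS = ℕ → ℕ

sumUpTo : (ℕ → ℕ) → ℕ → ℕ
sumUpTo f zero    = f zero
sumUpTo f (suc n) = sumUpTo f n + f (suc n)

sumFrom1 : (ℕ → ℕ) → ℕ → ℕ
sumFrom1 f zero    = 0
sumFrom1 f (suc n) = sumFrom1 f n + f (suc n)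

_⊛_ : FPS → FPS → FPS
(f ⊛ g) n = sumUpTo (λ k → f k * g (n ∸ k)) n

_·_ : ℕ → FPS → FPS
(a · f) n = a * f n

-- 1/(1-q) = Σ_{k≥0} q^k
geom : FPS
geom _ = 1

-- q^a/(1-q^a) = Σ_{k≥1} q^{k a}   (for a ≥ 1)
qOverOneMinus : (a : ℕ) .{{_ : NonZero a}} → FPS
qOverOneMinus a zero    = 0
qOverOneMinus a (suc n) = if ⌊ a ∣? suc n ⌋ then 1 else 0

-- Σ_{i≥1} q^{B^i}/(1-q^{B^i}) as a formally summable series: the i-th term
-- has order B^i > i, so only i = 1..n contribute to the coefficient of q^n
lambertSum : (B : ℕ) .{{_ : NonZero B}} → FPS
lambertSum B n = sumFrom1 (λ i → qOverOneMinus (B ^ i) {{m^n≢0 B i}} n) n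
  where open import Data.Nat.Properties using (m^n≢0)

lhsSeries : (B : ℕ) .{{_ : NonZero B}} → FPS
lhsSeries B zero    = 0
lhsSeries B (suc n) = ĉ B (replicate (suc n) 1)

rhsSeries : (B : ℕ) .{{_ : NonZero B}} → FPS
rhsSeries B = (B ∸ 1) · (geom ⊛ lambertSum B)

{-# OPTIONS --safe #-}
module Submission where

-- For a list of n ones there is a single column, so every carry quantity of
-- ĉ_B({1}^n) equals β = ⌊n/B⌋.  The coefficient of q^n on the right is
-- (B−1)·P(n) with P(n) = Σ_{i≥1} ⌊n/B^i⌋, and P(n) = ⌊n/B⌋ + P(⌊n/B⌋).  Running
-- this recursion alongside s_B(n) = (n mod B) + s_B(⌊n/B⌋) gives Legendre's
-- identity (B−1)·P(n) + s_B(n) = n, so β − s_B(β) = (B−1)·P(β) and the left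
-- coefficient is (B−1)·(P(β) + β) = (B−1)·P(n).

open import Defs
open import Data.Nat using (ℕ; zero; suc; _+_; _*_; _∸_; _^_; _≤_; _<_; _≤′_; ≤′-reflexive; ≤′-step; z≤n; s≤s; NonZero)
open import Data.Nat.Properties
open import Data.Nat.DivMod using (_/_; _%_; m≡m%n+[m/n]*n; m%n<n; m/n<m)
open import Data.Nat.Divisibility using (_∣_; _∣?_; divides; ∣⇒≤; ∣-trans; m∣m*n; n∣m*n; ∣m+n∣m⇒∣n; *-monoˡ-∣; *-cancelʳ-∣)
open import Data.Nat.Induction using (<-rec)
open import Data.Nat.Tactic.RingSolver using (solve-∀)
open import Data.List using (replicate)
open import Data.Nat.ListAction using (sum)
open import Data.Bool using (false)
open import Function using (_∘_)
open import Relation.Nullary using (¬_; yes; no; contradiction)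
open import Relation.Binary.PropositionalEquality
open ≡-Reasoning

sumUpTo-cong : ∀ {f g : ℕ → ℕ} → (∀ k → f k ≡ g k) → ∀ n → sumUpTo f n ≡ sumUpTo g n
sumUpTo-cong f≗g zero    = f≗g zero
sumUpTo-cong f≗g (suc n) = cong₂ _+_ (sumUpTo-cong f≗g n) (f≗g (suc n))

sumUpTo-head : ∀ (f : ℕ → ℕ) n → sumUpTo f (suc n) ≡ f 0 + sumUpTo (f ∘ suc) n
sumUpTo-head f zero    = refl
sumUpTo-head f (suc n) =
  trans (cong (_+ f (suc (suc n))) (sumUpTo-head f n)) (+-assoc (f 0) _ _)

sumUpTo-reverse : ∀ (f : ℕ → ℕ) n → sumUpTo (λ k → f (n ∸ k)) n ≡ sumUpTo f n
sumUpTo-reverse f zero    = refl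
sumUpTo-reverse f (suc n) = begin
  sumUpTo (λ k → f (suc n ∸ k)) (suc n) ≡⟨ sumUpTo-head (λ k → f (suc n ∸ k)) n ⟩
  f (suc n) + sumUpTo (λ k → f (n ∸ k)) n ≡⟨ cong (f (suc n) +_) (sumUpTo-reverse f n) ⟩
  f (suc n) + sumUpTo f n                 ≡⟨ +-comm (f (suc n)) _ ⟩
  sumUpTo f (suc n)                       ∎

geom-⊛ : ∀ (f : FPS) n → (geom ⊛ f) n ≡ sumUpTo f n
geom-⊛ f n =
  trans (sumUpTo-cong (λ k → *-identityˡ (f (n ∸ k))) n) (sumUpTo-reverse f n)

sumFrom1-cong : ∀ {f g : ℕ → ℕ} → (∀ k → f k ≡ g k) → ∀ n → sumFrom1 f n ≡ sumFrom1 g n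
sumFrom1-cong f≗g zero    = refl
sumFrom1-cong f≗g (suc n) = cong₂ _+_ (sumFrom1-cong f≗g n) (f≗g (suc n))

sumFrom1-head : ∀ (f : ℕ → ℕ) n → sumFrom1 f (suc n) ≡ f 1 + sumFrom1 (f ∘ suc) n
sumFrom1-head f zero    = +-comm 0 (f 1)
sumFrom1-head f (suc n) =
  trans (cong (_+ f (suc (suc n))) (sumFrom1-head f n)) (+-assoc (f 1) _ _)

sumFrom1-zero : ∀ {f : ℕ → ℕ} → (∀ k → f (suc k) ≡ 0) → ∀ n → sumFrom1 f n ≡ 0
sumFrom1-zero f≗0 zero    = refl
sumFrom1-zero f≗0 (suc n) = cong₂ _+_ (sumFrom1-zero f≗0 n) (f≗0 n)

sumFrom1-stable : ∀ {f : ℕ → ℕ} {n N} → (∀ i → n < i → f i ≡ 0) → n ≤′ N →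
                  sumFrom1 f N ≡ sumFrom1 f n
sumFrom1-stable f≗0 (≤′-reflexive refl) = refl
sumFrom1-stable {f} {n} {suc N} f≗0 (≤′-step n≤′N) = begin
  sumFrom1 f N + f (suc N) ≡⟨ cong₂ _+_ (sumFrom1-stable f≗0 n≤′N) (f≗0 (suc N) (s≤s (≤′⇒≤ n≤′N))) ⟩
  sumFrom1 f n + 0         ≡⟨ +-identityʳ _ ⟩
  sumFrom1 f n             ∎

qOverOneMinus-∣ : ∀ a .{{_ : NonZero a}} {m} → a ∣ suc m → qOverOneMinus a (suc m) ≡ 1
qOverOneMinus-∣ a {m} a∣m with a ∣? suc m
... | yes _  = refl
... | no a∤m = contradiction a∣m a∤m

qOverOneMinus-∤ : ∀ a .{{_ : NonZero a}} {m} → ¬ a ∣ suc m → qOverOneMinus a (suc m) ≡ 0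
qOverOneMinus-∤ a {m} a∤m with a ∣? suc m
... | yes a∣m = contradiction a∣m a∤m
... | no _    = refl

qOverOneMinus-⇔ : ∀ a .{{_ : NonZero a}} a′ .{{_ : NonZero a′}} {m m′} →
                  (a ∣ suc m → a′ ∣ suc m′) → (a′ ∣ suc m′ → a ∣ suc m) →
                  qOverOneMinus a (suc m) ≡ qOverOneMinus a′ (suc m′)
qOverOneMinus-⇔ a a′ {m} {m′} to from with a′ ∣? suc m′
... | yes a′∣m′ = qOverOneMinus-∣ a (from a′∣m′)
... | no a′∤m′  = qOverOneMinus-∤ a (a′∤m′ ∘ to)

-- The base is written B = suc (suc b), so that B ∸ 1 reduces to suc b.
module _ (b : ℕ) where

  private
    B : ℕ
    B = suc (suc b)

    1<B : 1 < B
    1<B = s≤s (s≤s z≤n)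

  digit-zero : ∀ j → digit B j 0 ≡ 0
  digit-zero zero    = refl
  digit-zero (suc j) = digit-zero j

  digit-≥ : ∀ j a → a ≤ j → digit B j a ≡ 0
  digit-≥ zero    zero    _   = refl
  digit-≥ (suc j) zero    _   = digit-zero j
  digit-≥ (suc j) (suc a) a≤j =
    digit-≥ j (suc a / B) (≤-pred (≤-trans (m/n<m (suc a) B 1<B) a≤j))

  digitSumUpTo-suc : ∀ m a → digitSumUpTo B (suc m) a ≡ a % B + digitSumUpTo B m (a / B)
  digitSumUpTo-suc zero    a = refl
  digitSumUpTo-suc (suc m) a =
    trans (cong (_+ digit B (suc (suc m)) a) (digitSumUpTo-suc m a)) (+-assoc (a % B) _ _)

  digitSumUpTo-≥ : ∀ {a m} → a ≤′ m → digitSumUpTo B m a ≡ s B a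
  digitSumUpTo-≥ (≤′-reflexive refl) = refl
  digitSumUpTo-≥ {a} {suc m} (≤′-step a≤′m) =
    trans (cong₂ _+_ (digitSumUpTo-≥ a≤′m) (digit-≥ (suc m) a (m≤n⇒m≤1+n (≤′⇒≤ a≤′m))))
          (+-identityʳ (s B a))

  s-/ : ∀ a → s B a ≡ a % B + s B (a / B)
  s-/ zero    = refl
  s-/ (suc a) = trans (digitSumUpTo-suc a (suc a))
    (cong (suc a % B +_) (digitSumUpTo-≥ (≤⇒≤′ (≤-pred (m/n<m (suc a) B 1<B)))))

  someNonzero-ones : ∀ j m → someNonzero B (replicate m 1) (suc j) ≡ false
  someNonzero-ones j zero    = refl
  someNonzero-ones j (suc m) rewrite digit-zero j = someNonzero-ones j m

  topFrom-ones : ∀ j m → topFrom B (replicate m 1) j ≡ 0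
  topFrom-ones zero    m = refl
  topFrom-ones (suc j) m rewrite someNonzero-ones j m = topFrom-ones j m

  colSum-ones : ∀ m → colSum B (replicate m 1) 0 ≡ m
  colSum-ones zero    = refl
  colSum-ones (suc m) = cong suc (colSum-ones m)

  ĉ-ones : ∀ m → ĉ B (replicate m 1) ≡ (m / B ∸ s B (m / B)) + suc b * (m / B)
  ĉ-ones m = cong₂ (λ x y → (x ∸ s B x) + suc b * y) β-ones c-ones
    where
    ones = replicate m 1
    carry-ones : carry B ones 0 ≡ m / B
    carry-ones = cong (_/ B) (colSum-ones m)
    β-ones : β B ones ≡ m / B
    β-ones = trans (cong (carry B ones) (topFrom-ones (sum ones) m)) carry-ones
    c-ones : c B ones ≡ m / B
    c-ones = trans (cong (carrySumUpTo B ones) (topFrom-ones (sum ones) m)) carry-ones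

  n<B^n : ∀ n → n < B ^ n
  n<B^n zero    = s≤s z≤n
  n<B^n (suc n) = ≤-<-trans (n<B^n n)
    (subst (B ^ n <_) (*-comm (B ^ n) B) (m<m*n (B ^ n) B {{m^n≢0 B n}} 1<B))

  lambertTerm : ℕ → FPS
  lambertTerm i = qOverOneMinus (B ^ i) {{m^n≢0 B i}}

  lambertTerm-beyond : ∀ i m → suc m < i → lambertTerm i (suc m) ≡ 0
  lambertTerm-beyond i m m<i = qOverOneMinus-∤ (B ^ i) {{m^n≢0 B i}}
    λ B^i∣m → <⇒≱ (<-trans m<i (n<B^n i)) (∣⇒≤ B^i∣m)

  lambertSum-truncate : ∀ m N → suc m ≤′ N →
                        sumFrom1 (λ i → lambertTerm i (suc m)) N ≡ lambertSum B (suc m)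
  lambertSum-truncate m N = sumFrom1-stable (λ i → lambertTerm-beyond i m)

  lambertSum-∤ : ∀ m → ¬ B ∣ suc m → lambertSum B (suc m) ≡ 0
  lambertSum-∤ m B∤m = sumFrom1-zero
    (λ j → qOverOneMinus-∤ (B ^ suc j) {{m^n≢0 B (suc j)}} (B∤m ∘ ∣-trans (m∣m*n (B ^ j))))
    (suc m)

  lambertSum-* : ∀ k → lambertSum B (suc k * B) ≡ 1 + lambertSum B (suc k)
  lambertSum-* k = begin
    lambertSum B (suc k * B)
      ≡⟨ sumFrom1-head (λ i → lambertTerm i (suc k * B)) M ⟩
    lambertTerm 1 (suc k * B) + sumFrom1 (λ i → lambertTerm (suc i) (suc k * B)) M
      ≡⟨ cong₂ _+_ (qOverOneMinus-∣ (B ^ 1) B∣kB) (sumFrom1-cong lambertTerm-suc M) ⟩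
    1 + sumFrom1 (λ i → lambertTerm i (suc k)) M
      ≡⟨ cong (1 +_) (lambertSum-truncate k M (≤⇒≤′ (s≤s (≤-trans (m≤m*n k B) (m≤n+m (k * B) b))))) ⟩
    1 + lambertSum B (suc k) ∎
    where
    M = suc (b + k * B)
    B∣kB : B ^ 1 ∣ suc k * B
    B∣kB = divides (suc k) (cong (suc k *_) (sym (*-identityʳ B)))
    lambertTerm-suc : ∀ j → lambertTerm (suc j) (suc k * B) ≡ lambertTerm j (suc k)
    lambertTerm-suc j = qOverOneMinus-⇔ (B ^ suc j) {{m^n≢0 B (suc j)}} (B ^ j) {{m^n≢0 B j}}
      (λ d → *-cancelʳ-∣ B (subst (_∣ suc k * B) (*-comm B (B ^ j)) d))
      (λ d → subst (_∣ suc k * B) (*-comm (B ^ j) B) (*-monoˡ-∣ B d))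

  -- Coefficient of q^n in Σ_{i≥1} q^{B^i}/(1−q)(1−q^{B^i}), i.e. Σ_{i≥1} ⌊n/B^i⌋.
  lambertPartialSum : FPS
  lambertPartialSum = sumUpTo (lambertSum B)

  lambertPartialSum-block : ∀ q r → r < B → lambertPartialSum (r + q * B) ≡ lambertPartialSum (q * B)
  lambertPartialSum-block q zero    _   = refl
  lambertPartialSum-block q (suc r) r<B =
    trans (cong₂ _+_ (lambertPartialSum-block q r (<⇒≤ r<B)) (lambertSum-∤ (r + q * B) B∤))
          (+-identityʳ _)
    where
    B∤ : ¬ B ∣ suc r + q * B
    B∤ B∣ = <⇒≱ r<B (∣⇒≤ (∣m+n∣m⇒∣n (subst (B ∣_) (+-comm (suc r) (q * B)) B∣) (n∣m*n q)))

  lambertPartialSum-* : ∀ q → lambertPartialSum (q * B) ≡ q + lambertPartialSum q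
  lambertPartialSum-* zero    = refl
  lambertPartialSum-* (suc q) = begin
    -- the left side of this chain is lambertPartialSum (suc q * B) unfolded once
    lambertPartialSum (suc b + q * B) + lambertSum B (suc q * B)
      ≡⟨ cong₂ _+_ (trans (lambertPartialSum-block q (suc b) ≤-refl) (lambertPartialSum-* q))
                   (lambertSum-* q) ⟩
    (q + lambertPartialSum q) + (1 + lambertSum B (suc q))
      ≡⟨ regroup q (lambertPartialSum q) (lambertSum B (suc q)) ⟩
    suc q + lambertPartialSum (suc q) ∎
    where
    regroup : ∀ m P L → (m + P) + (1 + L) ≡ suc m + (P + L)
    regroup = solve-∀

  lambertPartialSum-/ : ∀ n → lambertPartialSum n ≡ n / B + lambertPartialSum (n / B)
  lambertPartialSum-/ n = begin
    lambertPartialSum n                   ≡⟨ cong lambertPartialSum (m≡m%n+[m/n]*n n B) ⟩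
    lambertPartialSum (n % B + n / B * B) ≡⟨ lambertPartialSum-block (n / B) (n % B) (m%n<n n B) ⟩
    lambertPartialSum (n / B * B)         ≡⟨ lambertPartialSum-* (n / B) ⟩
    n / B + lambertPartialSum (n / B)     ∎

  legendre : ∀ n → suc b * lambertPartialSum n + s B n ≡ n
  legendre = <-rec _ step
    where
    step : ∀ n → (∀ {m} → m < n → suc b * lambertPartialSum m + s B m ≡ m) →
           suc b * lambertPartialSum n + s B n ≡ n
    step zero    _  = trans (+-identityʳ _) (*-zeroʳ (suc b))
    step (suc n) ih = begin
      suc b * P (suc n) + s B (suc n)
        ≡⟨ cong₂ (λ x y → suc b * x + y) (lambertPartialSum-/ (suc n)) (s-/ (suc n)) ⟩
      suc b * (d + P d) + (r + s B d)
        ≡⟨ regroup (suc b) d (P d) r (s B d) ⟩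
      r + suc b * d + (suc b * P d + s B d)
        ≡⟨ cong (r + suc b * d +_) (ih (m/n<m (suc n) B 1<B)) ⟩
      r + suc b * d + d
        ≡⟨ collect r b d ⟩
      r + d * B
        ≡⟨ m≡m%n+[m/n]*n (suc n) B ⟨
      suc n ∎
      where
      P = lambertPartialSum
      d = suc n / B
      r = suc n % B
      regroup : ∀ k d X r Y → k * (d + X) + (r + Y) ≡ r + k * d + (k * X + Y)
      regroup = solve-∀
      collect : ∀ r b d → r + suc b * d + d ≡ r + d * suc (suc b)
      collect = solve-∀

  lhsSeries-coeff : ∀ n → lhsSeries B n ≡ suc b * lambertPartialSum n
  lhsSeries-coeff zero    = sym (*-zeroʳ (suc b))
  lhsSeries-coeff (suc n) = begin
    ĉ B (replicate (suc n) 1)      ≡⟨ ĉ-ones (suc n) ⟩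
    (d ∸ s B d) + suc b * d        ≡⟨ cong (λ x → (x ∸ s B d) + suc b * d) (legendre d) ⟨
    (suc b * P d + s B d ∸ s B d) + suc b * d
                                   ≡⟨ cong (_+ suc b * d) (m+n∸n≡m (suc b * P d) (s B d)) ⟩
    suc b * P d + suc b * d        ≡⟨ *-distribˡ-+ (suc b) (P d) d ⟨
    suc b * (P d + d)              ≡⟨ cong (suc b *_) (+-comm (P d) d) ⟩
    suc b * (d + P d)              ≡⟨ cong (suc b *_) (lambertPartialSum-/ (suc n)) ⟨
    suc b * P (suc n)              ∎
    where
    P = lambertPartialSum
    d = suc n / B

  rhsSeries-coeff : ∀ n → rhsSeries B n ≡ suc b * lambertPartialSum n
  rhsSeries-coeff n = cong (suc b *_) (geom-⊛ (lambertSum B) n)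

corollary2p7 : (B : ℕ) .{{_ : NonZero B}} → 2 ≤ B →
               (n : ℕ) → lhsSeries B n ≡ rhsSeries B n
corollary2p7 (suc (suc b)) (s≤s (s≤s _)) n = trans (lhsSeries-coeff b n) (sym (rhsSeries-coeff b n))
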